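{- Let $G,H$ be simple graphs, $k$ a positive integer, and $u\in V(G)$, $v\in V(H)$ with $d^G(u)\ge k$ and $d^H(v)\ge k$. Then $$C_k^{G\times H}((u,v)) = k!\,C_k^G(u)\,C_k^H(v)\,D(G,H,k,u,v),\qquad\text{where}\quad D(G,H,k,u,v)=\frac{\binom{d^G(u)}{k}\binom{d^H(v)}{k}}{\binom{d^G(u)d^H(v)}{k}}.$$
   Context: For a graph $F$ and vertex $w$, $N(w)$ is the set of vertices adjacent to $w$ ($w\notin N(w)$), $d^F(w)=|N(w)|$ is the degree, and $A_k^F(w)$ is the number of $k$-cliques (sets of $k$ pairwise adjacent vertices) contained in $N(w)$. The $k$-clustering coefficient is $C_k^F(w)=A_k^F(w)/\binom{d^F(w)}{k}$ (defined when $d^F(w)\ge k$). The tensor product $G\times H$ of graphs $G=(V_1,E_1)$, $H=(V_2,E_2)$ has vertex set $V_1\times V_2$, with $(v_1,v_2)$ adjacent to $(v_1',v_2')$ if and only if $v_1v_1'\in E_1$ and $v_2v_2'\in E_2$. -}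

module Defs where

open import Data.Bool using (Bool; true; false; _∧_)
open import Data.Nat using (ℕ; zero; suc; _*_)
open import Data.Nat.Combinatorics using (_C_)
open import Data.Fin using (Fin; remQuot)
open import Data.List using (List; []; _∷_; filter; length; map; allFin)
open import Data.Bool.ListAction using (and)
open import Data.Product using (_,_; proj₁; proj₂)
open import Data.Integer using (+_)
open import Data.Rational using (ℚ; _/_; 0ℚ)
open import Relation.Binary.PropositionalEquality using (_≡_; refl; cong₂)
open import Data.Bool.Properties using (∧-zeroʳ)
open import Relation.Nullary.Decidable using (Dec; yes; no)
open import Data.Bool using (T)
open import Data.Bool.Properties using (T?)

record Graph (n : ℕ) : Set where
  field
    adj    : Fin n → Fin n → Bool
    sym    : ∀ x y → adj x y ≡ adj y x
    irrefl : ∀ x → adj x x ≡ false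
open Graph public

N : ∀ {n} → Graph n → Fin n → List (Fin n)
N G w = filter (λ x → T? (adj G w x)) (allFin _)

deg : ∀ {n} → Graph n → Fin n → ℕ
deg G w = length (N G w)

choose : {A : Set} → ℕ → List A → List (List A)
choose zero    _        = [] ∷ []
choose (suc k) []       = []
choose (suc k) (x ∷ xs) = map (x ∷_) (choose k xs) Data.List.++ choose (suc k) xs

isClique : ∀ {n} → Graph n → List (Fin n) → Bool
isClique G []       = true
isClique G (x ∷ xs) = and (map (adj G x) xs) ∧ isClique G xs

countB : {A : Set} → (A → Bool) → List A → ℕ
countB p []       = 0
countB p (x ∷ xs) with p x
... | true  = suc (countB p xs)
... | false = countB p xs

A : ∀ {n} → ℕ → Graph n → Fin n → ℕ
A k G w = countB (isClique G) (choose k (N G w))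

-- a / b as a rational; the value for b = 0 is an arbitrary convention
-- (never used in the theorem, where all denominators are positive)
frac : ℕ → ℕ → ℚ
frac a zero    = 0ℚ
frac a (suc b) = (+ a) / suc b

Cl : ∀ {n} → ℕ → Graph n → Fin n → ℚ
Cl k G w = frac (A k G w) (deg G w C k)

-- tensor product G × H on Fin (m * n), vertex (a , b) encoded by Data.Fin.combine a b
tensorAdj : ∀ {m n} → Graph m → Graph n → Fin (m * n) → Fin (m * n) → Bool
tensorAdj {m} {n} G H x y =
  adj G (proj₁ (remQuot {m} n x)) (proj₁ (remQuot {m} n y))
  ∧ adj H (proj₂ (remQuot {m} n x)) (proj₂ (remQuot {m} n y))

tensorSym : ∀ {m n} (G : Graph m) (H : Graph n) x y → tensorAdj G H x y ≡ tensorAdj G H y x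
tensorSym {m} {n} G H x y =
  cong₂ _∧_ (sym G _ _) (sym H _ _)

tensorIrrefl : ∀ {m n} (G : Graph m) (H : Graph n) x → tensorAdj G H x x ≡ false
tensorIrrefl {m} {n} G H x rewrite irrefl G (proj₁ (remQuot {m} n x)) = refl

_⊗_ : ∀ {m n} → Graph m → Graph n → Graph (m * n)
G ⊗ H = record { adj = tensorAdj G H ; sym = tensorSym G H ; irrefl = tensorIrrefl G H }

-- Count cliques in order. An ordered k-clique of a list L is chosen vertex by vertex, each among
-- the common neighbours of the earlier ones; there are k! times as many of them as k-cliques,
-- because inserting a new vertex x into an ordered k-clique of N(x) can happen at k+1 places.
-- In G × H the neighbourhood of (u,v) is N(u) × N(v), and two of its vertices are adjacent iff both
-- coordinates are, so its ordered k-cliques are exactly the pairs of ordered k-cliques of N(u) and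
-- N(v). Hence A_k^{G×H}(u,v) = k! A_k^G(u) A_k^H(v) and d^{G×H}(u,v) = d^G(u) d^H(v), and the
-- formula is an identity of fractions whose denominators are positive because k ≤ d^G(u), d^H(v).
module Submission where

open import Defs hiding (sym)

module CliqueCounting where

  open import Data.Bool using (Bool; true; false; _∧_; if_then_else_)
  open import Data.Bool.Properties using (T?)
  open import Data.Bool.ListAction using (all)
  open import Data.Fin as Fin using (Fin; combine; _↑ˡ_; _↑ʳ_)
  open import Data.Fin.Properties using (remQuot-combine)
  open import Data.List
    using (List; []; _∷_; _++_; map; filterᵇ; length; tabulate; allFin; cartesianProductWith)
  open import Data.List.Properties using (map-cong; map-++; map-∘; filter-++; length-++; length-map; map-tabulate)
  open import Data.Nat using (ℕ; zero; suc; _+_; _*_; _!)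
  open import Data.Nat.ListAction using (sum)
  open import Data.Nat.ListAction.Properties using (sum-++)
  open import Data.Nat.Properties
    using (+-comm; +-identityʳ; *-zeroʳ; *-distribˡ-+; *-distribʳ-+; *-cancelˡ-≡; _!≢0; +-commutativeSemigroup)
  open import Algebra.Properties.CommutativeSemigroup +-commutativeSemigroup using (interchange; x∙yz≈y∙xz)
  open import Data.Nat.Tactic.RingSolver using (solve-∀)
  open import Data.Product using (proj₁; proj₂)
  open import Function using (_∘_; id)
  open import Relation.Binary.PropositionalEquality
    using (_≡_; refl; sym; trans; cong; cong₂; module ≡-Reasoning)
  open ≡-Reasoning

  private
    variable
      W X Y Z : Set

  ∑ : List X → (X → ℕ) → ℕ
  ∑ xs f = sum (map f xs)

  infix 2 ∑
  syntax ∑ xs (λ x → e) = ∑[ x ∈ xs ] e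

  ∑-cong : {f g : X → ℕ} → (∀ x → f x ≡ g x) → ∀ xs → ∑ xs f ≡ ∑ xs g
  ∑-cong f≗g xs = cong sum (map-cong f≗g xs)

  ∑-+ : (f g : X → ℕ) → ∀ xs → (∑[ x ∈ xs ] (f x + g x)) ≡ ∑ xs f + ∑ xs g
  ∑-+ f g []       = refl
  ∑-+ f g (x ∷ xs) = trans (cong (f x + g x +_) (∑-+ f g xs))
                           (interchange (f x) (g x) (∑ xs f) (∑ xs g))

  ∑-*ˡ : ∀ c (f : X → ℕ) xs → (∑[ x ∈ xs ] c * f x) ≡ c * ∑ xs f
  ∑-*ˡ c f []       = sym (*-zeroʳ c)
  ∑-*ˡ c f (x ∷ xs) = trans (cong (c * f x +_) (∑-*ˡ c f xs)) (sym (*-distribˡ-+ c (f x) (∑ xs f)))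

  ∑-product : (f : X → ℕ) (g : Y → ℕ) → ∀ xs ys →
              (∑[ x ∈ xs ] ∑[ y ∈ ys ] f x * g y) ≡ ∑ xs f * ∑ ys g
  ∑-product f g []       ys = refl
  ∑-product f g (x ∷ xs) ys = trans (cong₂ _+_ (∑-*ˡ (f x) g ys) (∑-product f g xs ys))
                                    (sym (*-distribʳ-+ (∑ ys g) (f x) (∑ xs f)))

  ∑-filterᵇ : (p : X → Bool) (f : X → ℕ) → ∀ xs →
              ∑ (filterᵇ p xs) f ≡ (∑[ x ∈ xs ] (if p x then f x else 0))
  ∑-filterᵇ p f []       = refl
  ∑-filterᵇ p f (x ∷ xs) with p x
  ... | true  = cong (f x +_) (∑-filterᵇ p f xs)
  ... | false = ∑-filterᵇ p f xs

  ∑-cartesianProductWith : (h : Z → ℕ) (f : X → Y → Z) → ∀ xs ys →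
    ∑ (cartesianProductWith f xs ys) h ≡ (∑[ x ∈ xs ] ∑[ y ∈ ys ] h (f x y))
  ∑-cartesianProductWith h f []       ys = refl
  ∑-cartesianProductWith h f (x ∷ xs) ys = begin
    sum (map h (map (f x) ys ++ cartesianProductWith f xs ys))
      ≡⟨ cong sum (map-++ h (map (f x) ys) _) ⟩
    sum (map h (map (f x) ys) ++ map h (cartesianProductWith f xs ys))
      ≡⟨ sum-++ (map h (map (f x) ys)) _ ⟩
    sum (map h (map (f x) ys)) + ∑ (cartesianProductWith f xs ys) h
      ≡⟨ cong₂ _+_ (cong sum (sym (map-∘ ys))) (∑-cartesianProductWith h f xs ys) ⟩
    (∑[ y ∈ ys ] h (f x y)) + (∑[ x′ ∈ xs ] ∑[ y ∈ ys ] h (f x′ y))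
      ∎

  filterᵇ-comm : (p q : X → Bool) → ∀ xs → filterᵇ p (filterᵇ q xs) ≡ filterᵇ q (filterᵇ p xs)
  filterᵇ-comm p q []       = refl
  filterᵇ-comm p q (x ∷ xs) with q x in qx | p x in px
  ... | true  | true  rewrite qx | px = cong (x ∷_) (filterᵇ-comm p q xs)
  ... | true  | false rewrite px      = filterᵇ-comm p q xs
  ... | false | true  rewrite qx      = filterᵇ-comm p q xs
  ... | false | false                 = filterᵇ-comm p q xs

  countB-++ : (p : X → Bool) → ∀ xs ys → countB p (xs ++ ys) ≡ countB p xs + countB p ys
  countB-++ p []       ys = refl
  countB-++ p (x ∷ xs) ys with p x
  ... | true  = cong suc (countB-++ p xs ys)
  ... | false = countB-++ p xs ys

  countB-map : (p : Y → Bool) (f : X → Y) → ∀ xs → countB p (map f xs) ≡ countB (p ∘ f) xs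
  countB-map p f []       = refl
  countB-map p f (x ∷ xs) with p (f x)
  ... | true  = cong suc (countB-map p f xs)
  ... | false = countB-map p f xs

  countB-∧ : (p q : X → Bool) → ∀ xs → countB (λ x → p x ∧ q x) xs ≡ countB q (filterᵇ p xs)
  countB-∧ p q []       = refl
  countB-∧ p q (x ∷ xs) with p x
  ... | false = countB-∧ p q xs
  ... | true with q x
  ...   | true  = cong suc (countB-∧ p q xs)
  ...   | false = countB-∧ p q xs

  filterᵇ-all-map-∷ : (p : X → Bool) (x : X) → ∀ yss →
    filterᵇ (all p) (map (x ∷_) yss) ≡ (if p x then map (x ∷_) (filterᵇ (all p) yss) else [])
  filterᵇ-all-map-∷ p x []         with p x
  ... | true  = refl
  ... | false = refl
  filterᵇ-all-map-∷ p x (ys ∷ yss) with p x | filterᵇ-all-map-∷ p x yss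
  ... | false | ih = ih
  ... | true  | ih with all p ys
  ...   | true  = cong ((x ∷ ys) ∷_) ih
  ...   | false = ih

  filterᵇ-all-choose : (p : X → Bool) → ∀ k xs → filterᵇ (all p) (choose k xs) ≡ choose k (filterᵇ p xs)
  filterᵇ-all-choose p zero    xs       = refl
  filterᵇ-all-choose p (suc k) []       = refl
  filterᵇ-all-choose p (suc k) (x ∷ xs)
    rewrite filter-++ (T? ∘ all p) (map (x ∷_) (choose k xs)) (choose (suc k) xs)
          | filterᵇ-all-map-∷ p x (choose k xs)
    with p x
  ... | true  = cong₂ _++_ (cong (map (x ∷_)) (filterᵇ-all-choose p k xs)) (filterᵇ-all-choose p (suc k) xs)
  ... | false = filterᵇ-all-choose p (suc k) xs

  countCliques : ∀ {n} → Graph n → ℕ → List (Fin n) → ℕ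
  countCliques G k L = countB (isClique G) (choose k L)

  -- The number of sequences x₁ … x_k of elements of L in which every x_j is R-related to all
  -- earlier x_i; for a graph adjacency relation these are the cliques of L listed in some order.
  countOrderedCliques : (X → X → Bool) → ℕ → List X → ℕ
  countOrderedCliques R zero    L = 1
  countOrderedCliques R (suc k) L = ∑[ x ∈ L ] countOrderedCliques R k (filterᵇ (R x) L)

  module _ {n} (G : Graph n) where

    countCliques-∷ : ∀ k x L →
      countCliques G (suc k) (x ∷ L) ≡ countCliques G k (filterᵇ (adj G x) L) + countCliques G (suc k) L
    countCliques-∷ k x L = begin
      countB (isClique G) (map (x ∷_) (choose k L) ++ choose (suc k) L)
        ≡⟨ countB-++ (isClique G) (map (x ∷_) (choose k L)) (choose (suc k) L) ⟩
      countB (isClique G) (map (x ∷_) (choose k L)) + countCliques G (suc k) L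
        ≡⟨ cong (_+ countCliques G (suc k) L) cliquesThroughX ⟩
      countCliques G k (filterᵇ (adj G x) L) + countCliques G (suc k) L
        ∎
      where
      cliquesThroughX : countB (isClique G) (map (x ∷_) (choose k L)) ≡ countCliques G k (filterᵇ (adj G x) L)
      cliquesThroughX = begin
        countB (isClique G) (map (x ∷_) (choose k L))
          ≡⟨ countB-map (isClique G) (x ∷_) (choose k L) ⟩
        countB (λ ys → all (adj G x) ys ∧ isClique G ys) (choose k L)
          ≡⟨ countB-∧ (all (adj G x)) (isClique G) (choose k L) ⟩
        countB (isClique G) (filterᵇ (all (adj G x)) (choose k L))
          ≡⟨ cong (countB (isClique G)) (filterᵇ-all-choose (adj G x) k L) ⟩
        countCliques G k (filterᵇ (adj G x) L)
          ∎

    -- An ordered (k+1)-clique of x ∷ L either avoids x, or arises from an ordered k-clique of the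
    -- neighbourhood of x by inserting x at one of k+1 positions.
    countOrderedCliques-∷ : ∀ k x L →
      countOrderedCliques (adj G) (suc k) (x ∷ L)
        ≡ countOrderedCliques (adj G) (suc k) L + suc k * countOrderedCliques (adj G) k (filterᵇ (adj G x) L)
    countOrderedCliques-∷ zero    x L = +-comm 1 (∑[ _ ∈ L ] 1)
    countOrderedCliques-∷ (suc k) x L = begin
      ord (suc k) (filterᵇ (R x) (x ∷ L)) + (∑[ y ∈ L ] ord (suc k) (filterᵇ (R y) (x ∷ L)))
        ≡⟨ cong₂ _+_ (cong (ord (suc k)) dropX) (∑-cong insertX L) ⟩
      F + (∑[ y ∈ L ] (ord (suc k) (filterᵇ (R y) L) + inserted y))
        ≡⟨ cong (F +_) (∑-+ (λ y → ord (suc k) (filterᵇ (R y) L)) inserted L) ⟩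
      F + (ord (suc (suc k)) L + ∑ L inserted)
        ≡⟨ cong (λ e → F + (ord (suc (suc k)) L + e)) allInserted ⟩
      F + (ord (suc (suc k)) L + suc k * F)
        ≡⟨ x∙yz≈y∙xz F (ord (suc (suc k)) L) (suc k * F) ⟩
      ord (suc (suc k)) L + suc (suc k) * F
        ∎
      where
      R = adj G
      ord = countOrderedCliques R
      F = ord (suc k) (filterᵇ (R x) L)

      inserted : Fin n → ℕ
      inserted y = if R x y then suc k * ord k (filterᵇ (R x) (filterᵇ (R y) L)) else 0

      dropX : filterᵇ (R x) (x ∷ L) ≡ filterᵇ (R x) L
      dropX rewrite irrefl G x = refl

      insertX : ∀ y → ord (suc k) (filterᵇ (R y) (x ∷ L)) ≡ ord (suc k) (filterᵇ (R y) L) + inserted y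
      insertX y rewrite Graph.sym G x y with R y x
      ... | true  = countOrderedCliques-∷ k x (filterᵇ (R y) L)
      ... | false = sym (+-identityʳ _)

      allInserted : ∑ L inserted ≡ suc k * F
      allInserted = begin
        ∑ L inserted
          ≡⟨ ∑-filterᵇ (R x) (λ y → suc k * ord k (filterᵇ (R x) (filterᵇ (R y) L))) L ⟨
        (∑[ y ∈ filterᵇ (R x) L ] suc k * ord k (filterᵇ (R x) (filterᵇ (R y) L)))
          ≡⟨ ∑-*ˡ (suc k) (λ y → ord k (filterᵇ (R x) (filterᵇ (R y) L))) (filterᵇ (R x) L) ⟩
        suc k * (∑[ y ∈ filterᵇ (R x) L ] ord k (filterᵇ (R x) (filterᵇ (R y) L)))
          ≡⟨ cong (suc k *_) (∑-cong (λ y → cong (ord k) (filterᵇ-comm (R x) (R y) L)) (filterᵇ (R x) L)) ⟩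
        suc k * F
          ∎

    countOrderedCliques≡k!*countCliques : ∀ k L → countOrderedCliques (adj G) k L ≡ k ! * countCliques G k L
    countOrderedCliques≡k!*countCliques zero    L       = refl
    countOrderedCliques≡k!*countCliques (suc k) []      = sym (*-zeroʳ (suc k !))
    countOrderedCliques≡k!*countCliques (suc k) (x ∷ L) = begin
      countOrderedCliques (adj G) (suc k) (x ∷ L)
        ≡⟨ countOrderedCliques-∷ k x L ⟩
      countOrderedCliques (adj G) (suc k) L + suc k * countOrderedCliques (adj G) k Nx
        ≡⟨ cong₂ (λ a b → a + suc k * b) (countOrderedCliques≡k!*countCliques (suc k) L)
                                         (countOrderedCliques≡k!*countCliques k Nx) ⟩
      suc k ! * countCliques G (suc k) L + suc k * (k ! * countCliques G k Nx)
        ≡⟨ regroup (suc k) (k !) (countCliques G (suc k) L) (countCliques G k Nx) ⟩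
      suc k ! * (countCliques G k Nx + countCliques G (suc k) L)
        ≡⟨ cong (suc k ! *_) (countCliques-∷ k x L) ⟨
      suc k ! * countCliques G (suc k) (x ∷ L)
        ∎
      where
      Nx = filterᵇ (adj G x) L
      regroup : ∀ s f a b → s * f * a + s * (f * b) ≡ s * f * (b + a)
      regroup = solve-∀

  module _ (RX : X → X → Bool) (RY : Y → Y → Bool) (RZ : Z → Z → Bool) (f : X → Y → Z)
           (RZ-f : ∀ x y x′ y′ → RZ (f x y) (f x′ y′) ≡ (RX x x′ ∧ RY y y′)) where

    filterᵇ-RZ-map : ∀ x y x′ ys →
      filterᵇ (RZ (f x y)) (map (f x′) ys) ≡ (if RX x x′ then map (f x′) (filterᵇ (RY y) ys) else [])
    filterᵇ-RZ-map x y x′ []        with RX x x′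
    ... | true  = refl
    ... | false = refl
    filterᵇ-RZ-map x y x′ (y′ ∷ ys) rewrite RZ-f x y x′ y′ with RX x x′ | filterᵇ-RZ-map x y x′ ys
    ... | false | ih = ih
    ... | true  | ih with RY y y′
    ...   | true  = cong (f x′ y′ ∷_) ih
    ...   | false = ih

    filterᵇ-cartesianProductWith : ∀ x y xs ys →
      filterᵇ (RZ (f x y)) (cartesianProductWith f xs ys)
        ≡ cartesianProductWith f (filterᵇ (RX x) xs) (filterᵇ (RY y) ys)
    filterᵇ-cartesianProductWith x y []        ys = refl
    filterᵇ-cartesianProductWith x y (x′ ∷ xs) ys
      rewrite filter-++ (T? ∘ RZ (f x y)) (map (f x′) ys) (cartesianProductWith f xs ys)
            | filterᵇ-RZ-map x y x′ ys
      with RX x x′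
    ... | true  = cong (map (f x′) (filterᵇ (RY y) ys) ++_) (filterᵇ-cartesianProductWith x y xs ys)
    ... | false = filterᵇ-cartesianProductWith x y xs ys

    countOrderedCliques-cartesianProductWith : ∀ k xs ys →
      countOrderedCliques RZ k (cartesianProductWith f xs ys)
        ≡ countOrderedCliques RX k xs * countOrderedCliques RY k ys
    countOrderedCliques-cartesianProductWith zero    xs ys = refl
    countOrderedCliques-cartesianProductWith (suc k) xs ys = begin
      (∑[ z ∈ xys ] countOrderedCliques RZ k (filterᵇ (RZ z) xys))
        ≡⟨ ∑-cartesianProductWith (λ z → countOrderedCliques RZ k (filterᵇ (RZ z) xys)) f xs ys ⟩
      (∑[ x ∈ xs ] ∑[ y ∈ ys ] countOrderedCliques RZ k (filterᵇ (RZ (f x y)) xys))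
        ≡⟨ ∑-cong (λ x → ∑-cong (λ y → factor x y) ys) xs ⟩
      (∑[ x ∈ xs ] ∑[ y ∈ ys ] countX x * countY y)
        ≡⟨ ∑-product countX countY xs ys ⟩
      countOrderedCliques RX (suc k) xs * countOrderedCliques RY (suc k) ys
        ∎
      where
      xys = cartesianProductWith f xs ys
      countX = λ x → countOrderedCliques RX k (filterᵇ (RX x) xs)
      countY = λ y → countOrderedCliques RY k (filterᵇ (RY y) ys)
      factor : ∀ x y → countOrderedCliques RZ k (filterᵇ (RZ (f x y)) xys) ≡ countX x * countY y
      factor x y = trans (cong (countOrderedCliques RZ k) (filterᵇ-cartesianProductWith x y xs ys))
                         (countOrderedCliques-cartesianProductWith k (filterᵇ (RX x) xs) (filterᵇ (RY y) ys))

  length-cartesianProductWith : (f : X → Y → Z) → ∀ xs ys →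
    length (cartesianProductWith f xs ys) ≡ length xs * length ys
  length-cartesianProductWith f []       ys = refl
  length-cartesianProductWith f (x ∷ xs) ys = begin
    length (map (f x) ys ++ cartesianProductWith f xs ys)
      ≡⟨ length-++ (map (f x) ys) ⟩
    length (map (f x) ys) + length (cartesianProductWith f xs ys)
      ≡⟨ cong₂ _+_ (length-map (f x) ys) (length-cartesianProductWith f xs ys) ⟩
    length ys + length xs * length ys
      ∎

  tabulate-↑ : ∀ m {n} (g : Fin (m + n) → X) → tabulate g ≡ tabulate (g ∘ (_↑ˡ n)) ++ tabulate (g ∘ (m ↑ʳ_))
  tabulate-↑ zero    g = refl
  tabulate-↑ (suc m) g = cong (g Fin.zero ∷_) (tabulate-↑ m (g ∘ Fin.suc))

  cartesianProductWith-map : (f : Y → Z → X) (h : W → Y) → ∀ ws zs →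
    cartesianProductWith f (map h ws) zs ≡ cartesianProductWith (f ∘ h) ws zs
  cartesianProductWith-map f h []       zs = refl
  cartesianProductWith-map f h (w ∷ ws) zs = cong (map (f (h w)) zs ++_) (cartesianProductWith-map f h ws zs)

  tabulate-combine : ∀ m {n} (g : Fin (m * n) → X) →
    tabulate g ≡ cartesianProductWith (λ i j → g (combine i j)) (allFin m) (allFin n)
  tabulate-combine zero    g = refl
  tabulate-combine (suc m) {n} g = begin
    tabulate g
      ≡⟨ tabulate-↑ n g ⟩
    tabulate (g ∘ (_↑ˡ m * n)) ++ tabulate (g ∘ (n ↑ʳ_))
      ≡⟨ cong₂ _++_ (sym (map-tabulate id (F Fin.zero))) (tabulate-combine m (g ∘ (n ↑ʳ_))) ⟩
    map (F Fin.zero) (allFin n) ++ cartesianProductWith (F ∘ Fin.suc) (allFin m) (allFin n)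
      ≡⟨ cong (map (F Fin.zero) (allFin n) ++_) (cartesianProductWith-map F Fin.suc (allFin m) (allFin n)) ⟨
    map (F Fin.zero) (allFin n) ++ cartesianProductWith F (map Fin.suc (allFin m)) (allFin n)
      ≡⟨ cong (λ is → cartesianProductWith F (Fin.zero ∷ is) (allFin n)) (map-tabulate id Fin.suc) ⟩
    cartesianProductWith F (allFin (suc m)) (allFin n)
      ∎
    where
    F = λ i j → g (combine i j)

  module _ {m n} (G : Graph m) (H : Graph n) where

    adj-⊗-combine : ∀ a b a′ b′ → adj (G ⊗ H) (combine a b) (combine a′ b′) ≡ (adj G a a′ ∧ adj H b b′)
    adj-⊗-combine a b a′ b′ =
      cong₂ _∧_ (cong₂ (adj G) (cong proj₁ ab) (cong proj₁ a′b′)) (cong₂ (adj H) (cong proj₂ ab) (cong proj₂ a′b′))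
      where
      ab = remQuot-combine {m} {n} a b
      a′b′ = remQuot-combine {m} {n} a′ b′

    N-⊗ : ∀ u v → N (G ⊗ H) (combine u v) ≡ cartesianProductWith combine (N G u) (N H v)
    N-⊗ u v = begin
      filterᵇ (adj (G ⊗ H) (combine u v)) (allFin (m * n))
        ≡⟨ cong (filterᵇ (adj (G ⊗ H) (combine u v))) (tabulate-combine m id) ⟩
      filterᵇ (adj (G ⊗ H) (combine u v)) (cartesianProductWith combine (allFin m) (allFin n))
        ≡⟨ filterᵇ-cartesianProductWith (adj G) (adj H) (adj (G ⊗ H)) combine adj-⊗-combine u v (allFin m) (allFin n) ⟩
      cartesianProductWith combine (N G u) (N H v)
        ∎

    deg-⊗ : ∀ u v → deg (G ⊗ H) (combine u v) ≡ deg G u * deg H v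
    deg-⊗ u v = trans (cong length (N-⊗ u v)) (length-cartesianProductWith combine (N G u) (N H v))

    A-⊗ : ∀ k u v → A k (G ⊗ H) (combine u v) ≡ k ! * (A k G u * A k H v)
    A-⊗ k u v = *-cancelˡ-≡ _ _ (k !) {{k !≢0}} (begin
      k ! * A k (G ⊗ H) (combine u v)
        ≡⟨ countOrderedCliques≡k!*countCliques (G ⊗ H) k (N (G ⊗ H) (combine u v)) ⟨
      countOrderedCliques (adj (G ⊗ H)) k (N (G ⊗ H) (combine u v))
        ≡⟨ cong (countOrderedCliques (adj (G ⊗ H)) k) (N-⊗ u v) ⟩
      countOrderedCliques (adj (G ⊗ H)) k (cartesianProductWith combine (N G u) (N H v))
        ≡⟨ countOrderedCliques-cartesianProductWith (adj G) (adj H) (adj (G ⊗ H)) combine adj-⊗-combine k (N G u) (N H v) ⟩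
      countOrderedCliques (adj G) k (N G u) * countOrderedCliques (adj H) k (N H v)
        ≡⟨ cong₂ _*_ (countOrderedCliques≡k!*countCliques G k (N G u))
                     (countOrderedCliques≡k!*countCliques H k (N H v)) ⟩
      (k ! * A k G u) * (k ! * A k H v)
        ≡⟨ regroup (k !) (A k G u) (A k H v) ⟩
      k ! * (k ! * (A k G u * A k H v))
        ∎)
      where
      regroup : ∀ f a b → (f * a) * (f * b) ≡ f * (f * (a * b))
      regroup = solve-∀

open CliqueCounting using (deg-⊗; A-⊗)

open import Data.Fin using (Fin; combine)
open import Data.Integer using (+_)
open import Data.Integer.Properties using (pos-*)
open import Data.Nat using (ℕ; zero; suc; _≤_; _>_; z<s; s≤s; _!; >-nonZero) renaming (_*_ to _*ℕ_)
open import Data.Nat.Combinatorics using (_C_; nCk+nC[k+1]≡[n+1]C[k+1])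
open import Data.Nat.Properties using (≤-trans; ≤-reflexive; <-≤-trans; m≤m+n; m≤m*n)
open import Data.Nat.Tactic.RingSolver using (solve-∀)
open import Data.Rational using (_*_; _/_; toℚᵘ; fromℚᵘ)
open import Data.Rational.Properties using (fromℚᵘ-cong; fromℚᵘ-toℚᵘ; toℚᵘ-fromℚᵘ; toℚᵘ-homo-*)
open import Data.Rational.Unnormalised using (mkℚᵘ; *≡*) renaming (_*_ to _*ᵘ_)
open import Data.Rational.Unnormalised.Properties using (≃-trans) renaming (*-cong to *ᵘ-cong)
open import Relation.Binary.PropositionalEquality using (_≡_; sym; trans; cong; cong₂; module ≡-Reasoning)
open ≡-Reasoning

k≤n⇒nCk>0 : ∀ {n k} → k ≤ n → n C k > 0
k≤n⇒nCk>0 {n}     {zero}  _         = z<s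
k≤n⇒nCk>0 {suc n} {suc k} (s≤s k≤n) =
  <-≤-trans (k≤n⇒nCk>0 k≤n) (≤-trans (m≤m+n (n C k) (n C suc k)) (≤-reflexive (nCk+nC[k+1]≡[n+1]C[k+1] n k)))

frac-cong : ∀ a b c d → b > 0 → d > 0 → a *ℕ d ≡ c *ℕ b → frac a b ≡ frac c d
frac-cong a (suc b) c (suc d) _ _ eq =
  fromℚᵘ-cong {mkℚᵘ (+ a) b} {mkℚᵘ (+ c) d} (*≡* (trans (sym (pos-* a (suc d))) (trans (cong +_ eq) (pos-* c (suc b)))))

frac-* : ∀ a b c d → b > 0 → d > 0 → frac a b * frac c d ≡ frac (a *ℕ c) (b *ℕ d)
frac-* a (suc b) c (suc d) _ _ = begin
  frac a (suc b) * frac c (suc d)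
    ≡⟨ fromℚᵘ-toℚᵘ (frac a (suc b) * frac c (suc d)) ⟨
  fromℚᵘ (toℚᵘ (frac a (suc b) * frac c (suc d)))
    ≡⟨ fromℚᵘ-cong (≃-trans (toℚᵘ-homo-* (frac a (suc b)) (frac c (suc d)))
                            (*ᵘ-cong (toℚᵘ-fromℚᵘ (mkℚᵘ (+ a) b)) (toℚᵘ-fromℚᵘ (mkℚᵘ (+ c) d)))) ⟩
  fromℚᵘ (mkℚᵘ (+ a) b *ᵘ mkℚᵘ (+ c) d)
    ≡⟨ cong (λ i → i / (suc b *ℕ suc d)) (pos-* a c) ⟨
  frac (a *ℕ c) (suc b *ℕ suc d)
    ∎

frac-rearrange : ∀ K a b x y z → x > 0 → y > 0 → z > 0 →
  frac (K *ℕ (a *ℕ b)) z ≡ frac K 1 * frac a x * frac b y * frac (x *ℕ y) z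
frac-rearrange K a b x@(suc _) y@(suc _) z@(suc _) _ _ _ = begin
  frac (K *ℕ (a *ℕ b)) z
    ≡⟨ frac-cong (K *ℕ (a *ℕ b)) z (K *ℕ a *ℕ b *ℕ (x *ℕ y)) (1 *ℕ x *ℕ y *ℕ z) z<s z<s
                 (cross-multiply K a b x y z) ⟩
  frac (K *ℕ a *ℕ b *ℕ (x *ℕ y)) (1 *ℕ x *ℕ y *ℕ z)
    ≡⟨ frac-* (K *ℕ a *ℕ b) (1 *ℕ x *ℕ y) (x *ℕ y) z z<s z<s ⟨
  frac (K *ℕ a *ℕ b) (1 *ℕ x *ℕ y) * frac (x *ℕ y) z
    ≡⟨ cong (_* frac (x *ℕ y) z) (frac-* (K *ℕ a) (1 *ℕ x) b y z<s z<s) ⟨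
  frac (K *ℕ a) (1 *ℕ x) * frac b y * frac (x *ℕ y) z
    ≡⟨ cong (λ q → q * frac b y * frac (x *ℕ y) z) (frac-* K 1 a x z<s z<s) ⟨
  frac K 1 * frac a x * frac b y * frac (x *ℕ y) z
    ∎
  where
  cross-multiply : ∀ K a b x y z → K *ℕ (a *ℕ b) *ℕ (1 *ℕ x *ℕ y *ℕ z) ≡ K *ℕ a *ℕ b *ℕ (x *ℕ y) *ℕ z
  cross-multiply = solve-∀

proposition4p2 : ∀ {m n} (G : Graph m) (H : Graph n) (k : ℕ) → 1 ≤ k →
    (u : Fin m) (v : Fin n) → k ≤ deg G u → k ≤ deg H v →
    Cl k (G ⊗ H) (combine u v)
      ≡ frac (k !) 1 * Cl k G u * Cl k H v
        * frac ((deg G u C k) *ℕ (deg H v C k)) ((deg G u *ℕ deg H v) C k)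
proposition4p2 G H k 1≤k u v k≤dG k≤dH = begin
  frac (A k (G ⊗ H) (combine u v)) (deg (G ⊗ H) (combine u v) C k)
    ≡⟨ cong₂ frac (A-⊗ G H k u v) (cong (_C k) (deg-⊗ G H u v)) ⟩
  frac (k ! *ℕ (A k G u *ℕ A k H v)) ((deg G u *ℕ deg H v) C k)
    ≡⟨ frac-rearrange (k !) (A k G u) (A k H v) _ _ _ (k≤n⇒nCk>0 k≤dG) (k≤n⇒nCk>0 k≤dH) (k≤n⇒nCk>0 k≤dGdH) ⟩
  frac (k !) 1 * Cl k G u * Cl k H v * frac ((deg G u C k) *ℕ (deg H v C k)) ((deg G u *ℕ deg H v) C k)
    ∎
  where
  k≤dGdH : k ≤ deg G u *ℕ deg H v
  k≤dGdH = ≤-trans k≤dG (m≤m*n (deg G u) (deg H v) {{>-nonZero (≤-trans 1≤k k≤dH)}})
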